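{- Let $u\le v$ in $\mathfrak S_n$ and let $D=\mathrm{FPP}(u,v)$ be a flag positroid pipe dream of $u$ with exit permutation $v$. Let $s_{i_1},\dots,s_{i_m}$ be the simple transpositions associated to the $m$ boxes of $\mathrm{Rothe}(u)$, listed row by row from bottom to top and within each row from right to left, where the box which is the $h$-th box of $\mathrm{Rothe}(u)$ in row $i$ counted from the right is associated with $s_{i+h-1}$. Suppose that, in this linear order of the boxes of $\mathrm{Rothe}(u)$, the cross tiles of $D$ occupy positions $1\le p_1<p_2<\dots<p_l\le m$. Let $y=s_{i_{p_1}}s_{i_{p_2}}\cdots s_{i_{p_l}}$. Then $vy=w_0$, and this expression for $y$ is reduced.
   Context: Permutations $u=u_1\cdots u_n\in\mathfrak S_n$ are in one-line notation and multiplied as functions; $s_i=(i\ i{+}1)$, $w_0=n(n-1)\cdots1$; $\le$ is Bruhat order. Use an $n\times n$ array, box $(i,j)$ in row $i$ from the top, column $j$ from the left. $\mathrm{Rothe}(u)=\{(i,j):u_i<j,\ u^{ -1}(j)>i\}$. Tiles: empty; horizontal pipe (joins midpoints of left and right edges); vertical pipe (joins midpoints of top and bottom edges); pivot elbow (one arc joining top-edge midpoint to right-edge midpoint); cross (a horizontal and a vertical pipe); elbow (two arcs: top-edge midpoint to right-edge midpoint, and left-edge midpoint to bottom-edge midpoint). A Rothe pipe dream of $u$ is a tiling with: (i) $n$ pipes, each starting at the top edge and ending at the right edge; (ii) $(i,u_i)$ is a pivot elbow for each $i$; (iii) boxes $(i,j)$ with $u^{ -1}(j)<i$, $j<u_i$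 are empty; (iv) boxes $(i,j)$ with $u^{ -1}(j)<i$, $j>u_i$ are horizontal pipes; (v) boxes $(i,j)$ with $u^{ -1}(j)>i$, $j<u_i$ are vertical pipes (so boxes of $\mathrm{Rothe}(u)$ are crosses or elbows). It is reduced if no two pipes cross more than once. The pipe starting at the top of column $j$ is labelled $j$; the exit permutation $v$ has $v_i$ = label of the pipe leaving the right edge in row $i$. Two pipes touch if they pass through a common elbow tile. A flag positroid pipe dream $\mathrm{FPP}(u,v)$ is a reduced Rothe pipe dream of $u$ with exit permutation $v$ such that whenever two pipes cross, they do not touch in any box southeast of their crossing. -}

module Defs where

open import Data.Nat as ℕ using (ℕ; zero; suc; _+_; _∸_; _<ᵇ_)
open import Data.Nat.Properties using (≤-<-trans; m∸n≤m)
open import Data.Fin.Properties using (toℕ<n)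
open import Data.Fin as Fin using (Fin; toℕ; fromℕ<; opposite)
open import Data.Fin.Permutation using (Permutation′; _⟨$⟩ʳ_; _⟨$⟩ˡ_; transpose)
open import Data.Bool using (Bool; true; false; _∧_)
open import Data.List using (List; []; _∷_; map; concat; reverse; filterᵇ; allFin; length)
open import Data.List.Membership.Propositional using (_∈_)
open import Data.List.Relation.Unary.All using (All)
open import Data.Maybe using (Maybe; just; nothing)
open import Data.Product using (Σ; ∃; _×_; _,_)
open import Data.Sum using (_⊎_)
open import Relation.Binary.PropositionalEquality using (_≡_; _≢_; subst; sym)
open import Relation.Nullary using (¬_; yes; no)

-- Conventions: everything is 0-indexed.  Rows/columns/values are Fin n;
-- box (i , j) is row i from the top, column j from the left.
-- A permutation u ∈ S_n is a stdlib Permutation′ n; u_i is  u ⟨$⟩ʳ i,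
-- u⁻¹(j) is  u ⟨$⟩ˡ j.  Products are composition of functions.

⟦_⟧ : ∀ {n} → Permutation′ n → Fin n → Fin n
⟦ π ⟧ x = π ⟨$⟩ʳ x

-- w₀ = n (n-1) ⋯ 1, i.e. i ↦ n-1-i in 0-indexed form
w₀ : ∀ {n} → Fin n → Fin n
w₀ = opposite

-- Paper's simple transposition s_k = (k k+1) (1-indexed, 1 ≤ k ≤ n-1),
-- as a function on the 0-indexed values: swaps k-1 and k.
s : ∀ {n} → ℕ → Fin n → Fin n
s {n} k x with suc (toℕ x) ℕ.≟ k | toℕ x ℕ.≟ k
... | yes _ | _ with k ℕ.<? n
...   | yes p = fromℕ< p
...   | no _  = x
s {n} k x | no _ | yes e =
  fromℕ< (≤-<-trans (m∸n≤m k 1) (subst (ℕ._< n) e (toℕ<n x)))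
s {n} k x | no _ | no _ = x

prod : ∀ {n} → List ℕ → Fin n → Fin n
prod []      x = x
prod (k ∷ w) x = s k (prod w x)

IsWord : ℕ → List ℕ → Set
IsWord n w = All (λ k → 1 ℕ.≤ k × k ℕ.< n) w

Reduced : ℕ → List ℕ → Set
Reduced n w = ∀ (w' : List ℕ) → IsWord n w' →
  (∀ (x : Fin n) → prod w' x ≡ prod w x) → length w ℕ.≤ length w'

count : ∀ {A : Set} → (A → Bool) → List A → ℕ
count p xs = length (filterᵇ p xs)

inv : ∀ {n} → Permutation′ n → ℕ
inv {n} π = count (λ { (i , j) → (toℕ i <ᵇ toℕ j) ∧ (toℕ (⟦ π ⟧ j) <ᵇ toℕ (⟦ π ⟧ i)) })
                  (concat (map (λ i → map (λ j → (i , j)) (allFin n)) (allFin n)))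

BruhatStep : ∀ {n} → Permutation′ n → Permutation′ n → Set
BruhatStep {n} u w = Σ (Fin n) λ i → Σ (Fin n) λ j → i Fin.< j ×
  (∀ x → ⟦ w ⟧ x ≡ ⟦ u ⟧ (⟦ transpose i j ⟧ x)) × inv u ℕ.< inv w

data _≤B_ {n} : Permutation′ n → Permutation′ n → Set where
  ≤B-refl : ∀ {u v} → (∀ x → ⟦ u ⟧ x ≡ ⟦ v ⟧ x) → u ≤B v
  ≤B-step : ∀ {u w v} → BruhatStep u w → w ≤B v → u ≤B v

data Tile : Set where
  empty hpipe vpipe pivot cross elbow : Tile

Tiling : ℕ → Set
Tiling n = Fin n → Fin n → Tile

data Dir : Set where
  fromTop fromLeft : Dir

data Out : Set where
  goRight goDown : Out

route : Tile → Dir → Maybe Out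
route hpipe fromLeft = just goRight
route vpipe fromTop  = just goDown
route pivot fromTop  = just goRight
route cross fromTop  = just goDown
route cross fromLeft = just goRight
route elbow fromTop  = just goRight
route elbow fromLeft = just goDown
route _     _        = nothing

data End (n : ℕ) : Set where
  rightEdge  : Fin n → End n   -- leaves the right edge in this row
  bottomEdge : End n
  stuck      : End n

next : ∀ {n} → Fin n → Maybe (Fin n)
next {n} j with suc (toℕ j) ℕ.<? n
... | yes p = just (fromℕ< p)
... | no _  = nothing

Visit : ℕ → Set
Visit n = Fin n × Fin n × Dir

walk : ∀ {n} → Tiling n → ℕ → Fin n → Fin n → Dir → List (Visit n) × End n
walk D zero i j d = [] , stuck
walk D (suc f) i j d with route (D i j) d
... | nothing = [] , stuck
... | just goRight with next j
...   | nothing = ((i , j , d) ∷ []) , rightEdge i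
...   | just j' with walk D f i j' fromLeft
...     | (vs , e) = ((i , j , d) ∷ vs) , e
walk D (suc f) i j d | just goDown with next i
...   | nothing = ((i , j , d) ∷ []) , bottomEdge
...   | just i' with walk D f i' j fromTop
...     | (vs , e) = ((i , j , d) ∷ vs) , e

-- the pipe labelled k starts at the top edge of column k
pipe : ∀ {n} → Tiling n → Fin n → List (Visit n) × End n
pipe {suc m} D k = walk D (suc m + suc m) Fin.zero k fromTop

pathOf : ∀ {n} → Tiling n → Fin n → List (Visit n)
pathOf D k = Data.Product.proj₁ (pipe D k)

endOf : ∀ {n} → Tiling n → Fin n → End n
endOf D k = Data.Product.proj₂ (pipe D k)

Passes : ∀ {n} → Tiling n → Fin n → Fin n → Fin n → Set
Passes D k i j = ∃ λ d → (i , j , d) ∈ pathOf D k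

CrossAt : ∀ {n} → Tiling n → Fin n → Fin n → Fin n → Fin n → Set
CrossAt D a b i j = D i j ≡ cross × Passes D a i j × Passes D b i j

TouchAt : ∀ {n} → Tiling n → Fin n → Fin n → Fin n → Fin n → Set
TouchAt D a b i j = D i j ≡ elbow × Passes D a i j × Passes D b i j

InRothe : ∀ {n} → Permutation′ n → Fin n → Fin n → Set
InRothe u i j = ⟦ u ⟧ i Fin.< j × i Fin.< u ⟨$⟩ˡ j

record RothePD {n} (u : Permutation′ n) (D : Tiling n) : Set where
  field
    -- (i) every pipe starts at the top edge and ends at the right edge,
    --     and there are no other pipes: every arc of every tile lies on
    --     one of the n pipes started at the top edge
    endsRight : ∀ k → ∃ λ r → endOf D k ≡ rightEdge r
    covered   : ∀ i j d → route (D i j) d ≢ nothing →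
                ∃ λ k → (i , j , d) ∈ pathOf D k
    pivots    : ∀ i → D i (⟦ u ⟧ i) ≡ pivot
    empties   : ∀ i j → u ⟨$⟩ˡ j Fin.< i → j Fin.< ⟦ u ⟧ i → D i j ≡ empty
    hpipes    : ∀ i j → u ⟨$⟩ˡ j Fin.< i → ⟦ u ⟧ i Fin.< j → D i j ≡ hpipe
    vpipes    : ∀ i j → i Fin.< u ⟨$⟩ˡ j → j Fin.< ⟦ u ⟧ i → D i j ≡ vpipe
    rothe     : ∀ i j → InRothe u i j → D i j ≡ cross ⊎ D i j ≡ elbow

ReducedPD : ∀ {n} → Tiling n → Set
ReducedPD {n} D = ∀ (a b : Fin n) → a ≢ b → ∀ i j i' j' →
  CrossAt D a b i j → CrossAt D a b i' j' → (i ≡ i' × j ≡ j')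

HasExit : ∀ {n} → Tiling n → Permutation′ n → Set
HasExit D v = ∀ i → endOf D (⟦ v ⟧ i) ≡ rightEdge i

record IsFPP {n} (u v : Permutation′ n) (D : Tiling n) : Set where
  field
    rothePD : RothePD u D
    reduced : ReducedPD D
    exit    : HasExit D v
    noTouch : ∀ (a b : Fin n) → a ≢ b → ∀ i j → CrossAt D a b i j →
              ∀ i' j' → i Fin.< i' → j Fin.< j' → ¬ TouchAt D a b i' j'

number : ∀ {A : Set} → ℕ → List A → List (ℕ × A)
number h []       = []
number h (x ∷ xs) = (h , x) ∷ number (suc h) xs

rotheᵇ : ∀ {n} → Permutation′ n → Fin n → Fin n → Bool
rotheᵇ u i j = (toℕ (⟦ u ⟧ i) <ᵇ toℕ j) ∧ (toℕ i <ᵇ toℕ (u ⟨$⟩ˡ j))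

-- boxes of Rothe(u) in row i (0-indexed), right to left, each paired with
-- its simple transposition index: the h-th one from the right (h ≥ 1) gets
-- s_{(i+1)+h-1}, the paper's 1-indexed rule
rowBoxes : ∀ {n} → Permutation′ n → Fin n → List (ℕ × Fin n × Fin n)
rowBoxes {n} u i =
  map (λ { (h , j) → (toℕ i + h , i , j) })
      (number 1 (filterᵇ (rotheᵇ u i) (reverse (allFin n))))

rotheBoxes : ∀ {n} → Permutation′ n → List (ℕ × Fin n × Fin n)
rotheBoxes {n} u = concat (map (rowBoxes u) (reverse (allFin n)))

isCross : Tile → Bool
isCross cross = true
isCross _     = false

crossWord : ∀ {n} → Permutation′ n → Tiling n → List ℕ
crossWord u D =
  map (λ { (k , i , j) → k }) (filterᵇ (λ { (k , i , j) → isCross (D i j) }) (rotheBoxes u))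

-- Scan the boxes row by row from the top, each row from left to right, keeping the list of the
-- labels of the pipes crossing the boundary of the scanned region (its right side downwards, then
-- its lower side leftwards). Pipes, pivots and elbows leave this list unchanged, while a cross whose
-- two pipes sit at positions k, k+1 swaps them, i.e. acts by s_k; for the h-th Rothe box from the
-- right in row i one finds k = i+h-1. Prepending s_k at every cross thus builds the word y of the
-- statement, and the final list, which is v read down the right edge, equals w₀ read through y.
-- Since D is reduced, the two pipes meeting at a cross have not crossed before, so every letter
-- creates a new inversion: y has as many inversions as letters, and the number of inversions of a
-- permutation bounds the length of every word for it.
module Submission where

open import Defs
open import Data.Bool using (Bool; true; false; _∧_; if_then_else_; T)
open import Data.Bool.Properties using (∧-zeroʳ)
open import Data.Unit using (tt)
open import Data.Empty using (⊥-elim)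
open import Data.Fin as Fin using (Fin; toℕ; fromℕ<; punchIn)
open import Data.Fin.Properties as FinP using (toℕ<n; toℕ-injective; toℕ-fromℕ<; punchInᵢ≢i)
open import Data.Fin.Permutation using (Permutation′; _⟨$⟩ʳ_; _⟨$⟩ˡ_; inverseˡ; inverseʳ)
open import Data.List as List using (List; []; _∷_; _++_; length; reverse)
import Data.List.Properties as ListP
open import Data.List.Relation.Unary.All using ([]; _∷_)
open import Data.List.Relation.Unary.Any using (here; there)
open import Data.List.Membership.Propositional using (_∈_)
open import Data.List.Membership.Propositional.Properties using (∈-applyDownFrom⁻; ∈-downFrom⁻)
open import Data.Maybe using (just; nothing)
open import Data.Nat as ℕ using (ℕ; zero; suc; _+_; _∸_; _≤_; _<_; z≤n; s≤s)
import Data.Nat.Properties as ℕP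
open import Algebra.Properties.CommutativeMonoid.Sum ℕP.+-0-commutativeMonoid
  using (sum; sum-remove; sum-cong-≗; sum-replicate-zero)
open import Data.Product using (_×_; _,_; proj₁; proj₂; ∃-syntax)
open import Data.Sum as Sum using (_⊎_; inj₁; inj₂; fromInj₁)
open import Function using (_∘_)
open import Function.Definitions using (Injective)
open import Relation.Binary.Definitions using (Tri; tri<; tri≈; tri>)
open import Relation.Binary.PropositionalEquality
  using (_≡_; _≢_; refl; sym; trans; cong; cong₂; subst; subst₂; module ≡-Reasoning)
open import Relation.Nullary using (¬_; Dec; yes; no; _×-dec_; contradiction)
open import Relation.Nullary.Decidable using (T?)

s-lower : ∀ {n} k → k < n → (x : Fin n) → suc (toℕ x) ≡ k → toℕ (s k x) ≡ k
s-lower {n} k k<n x e with suc (toℕ x) ℕ.≟ k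
... | no e′ = ⊥-elim (e′ e)
... | yes _ with k ℕ.<? n
...   | yes p = toℕ-fromℕ< p
...   | no k≮n = ⊥-elim (k≮n k<n)

s-upper : ∀ {n} k (x : Fin n) → toℕ x ≡ k → toℕ (s k x) ≡ k ∸ 1
s-upper k x e with suc (toℕ x) ℕ.≟ k
... | yes e′ = ⊥-elim (ℕP.1+n≢n (trans e′ (sym e)))
... | no _ with toℕ x ℕ.≟ k
...   | yes _ = toℕ-fromℕ< _
...   | no e′ = ⊥-elim (e′ e)

s-fixed : ∀ {n} k (x : Fin n) → suc (toℕ x) ≢ k → toℕ x ≢ k → s k x ≡ x
s-fixed k x e₁ e₂ with suc (toℕ x) ℕ.≟ k
... | yes e = ⊥-elim (e₁ e)
... | no _ with toℕ x ℕ.≟ k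
...   | yes e = ⊥-elim (e₂ e)
...   | no _ = refl

data SView {n} (k : ℕ) (x : Fin n) : Set where
  lower : suc (toℕ x) ≡ k → toℕ (s k x) ≡ k → SView k x
  upper : toℕ x ≡ k → toℕ (s k x) ≡ k ∸ 1 → SView k x
  fixed : suc (toℕ x) ≢ k → toℕ x ≢ k → s k x ≡ x → SView k x

s-view : ∀ {n} k → k < n → (x : Fin n) → SView k x
s-view k k<n x = view (suc (toℕ x) ℕ.≟ k) (toℕ x ℕ.≟ k)
  where
  view : Dec (suc (toℕ x) ≡ k) → Dec (toℕ x ≡ k) → SView k x
  view (yes e) _       = lower e (s-lower k k<n x e)
  view (no e₁) (yes e₂) = upper e₂ (s-upper k x e₂)
  view (no e₁) (no e₂)  = fixed e₁ e₂ (s-fixed k x e₁ e₂)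

s-involutive : ∀ {n} k → 1 ≤ k → k < n → (x : Fin n) → s k (s k x) ≡ x
s-involutive k 1≤k k<n x with s-view k k<n x | s-view k k<n (s k x)
... | lower e₁ e₂ | lower f₁ f₂ = ⊥-elim (ℕP.1+n≢n (trans f₁ (sym e₂)))
... | lower e₁ e₂ | upper f₁ f₂ = toℕ-injective (trans f₂ (cong (_∸ 1) (sym e₁)))
... | lower e₁ e₂ | fixed f₁ f₂ f₃ = ⊥-elim (f₂ e₂)
... | upper e₁ e₂ | lower f₁ f₂ = toℕ-injective (trans f₂ (sym e₁))
... | upper e₁ e₂ | upper f₁ f₂ =
      ⊥-elim (ℕP.<-irrefl (trans (sym e₂) f₁) (ℕP.∸-monoʳ-< ℕ.z<s 1≤k))
... | upper e₁ e₂ | fixed f₁ f₂ f₃ = ⊥-elim (f₁ (trans (cong suc e₂) (ℕP.m+[n∸m]≡n 1≤k)))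
... | fixed e₁ e₂ e₃ | _ = trans (cong (s k) e₃) e₃

s-reflects-< : ∀ {n} k → k < n → (y z : Fin n) → s k y Fin.< s k z →
               y Fin.< z ⊎ (toℕ y ≡ k × suc (toℕ z) ≡ k)
s-reflects-< k k<n y z lt with s-view k k<n y | s-view k k<n z
... | lower a₁ a₂ | lower b₁ b₂ = ⊥-elim (ℕP.<-irrefl (trans a₂ (sym b₂)) lt)
... | lower a₁ a₂ | upper b₁ b₂ = inj₁ (ℕP.≤-reflexive (trans a₁ (sym b₁)))
... | lower a₁ a₂ | fixed b₁ b₂ b₃ =
      inj₁ (ℕP.<-trans (ℕP.≤-reflexive a₁) (subst₂ _<_ a₂ (cong toℕ b₃) lt))
... | upper a₁ a₂ | lower b₁ b₂ = inj₂ (a₁ , b₁)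
... | upper a₁ a₂ | upper b₁ b₂ = ⊥-elim (ℕP.<-irrefl (trans a₂ (sym b₂)) lt)
... | upper a₁ a₂ | fixed b₁ b₂ b₃ =
      inj₁ (subst (_< toℕ z) (sym a₁)
                  (ℕP.≤∧≢⇒< (ℕP.≤-trans (ℕP.m≤n+m∸n k 1) (subst₂ _<_ a₂ (cong toℕ b₃) lt))
                             (b₂ ∘ sym)))
... | fixed a₁ a₂ a₃ | lower b₁ b₂ =
      inj₁ (ℕP.≤∧≢⇒< (ℕP.m<1+n⇒m≤n (subst₂ _<_ (cong toℕ a₃) (trans b₂ (sym b₁)) lt))
                      (λ e → a₁ (trans (cong suc e) b₁)))
... | fixed a₁ a₂ a₃ | upper b₁ b₂ =
      inj₁ (subst (toℕ y <_) (sym b₁)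
                  (ℕP.<-≤-trans (subst₂ _<_ (cong toℕ a₃) b₂ lt) (ℕP.m∸n≤m k 1)))
... | fixed a₁ a₂ a₃ | fixed b₁ b₂ b₃ = inj₁ (subst₂ _<_ (cong toℕ a₃) (cong toℕ b₃) lt)

prod-++ : ∀ {n} (xs ys : List ℕ) (x : Fin n) → prod (xs ++ ys) x ≡ prod xs (prod ys x)
prod-++ []       ys x = refl
prod-++ (k ∷ xs) ys x = cong (s k) (prod-++ xs ys x)

prod-reverse-inverseˡ : ∀ {n w} → IsWord n w → ∀ (x : Fin n) → prod (reverse w) (prod w x) ≡ x
prod-reverse-inverseˡ {w = []} [] x = refl
prod-reverse-inverseˡ {w = k ∷ w} ((1≤k , k<n) ∷ ws) x = begin
  prod (reverse (k ∷ w)) (s k (prod w x))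
    ≡⟨ cong (λ l → prod l (s k (prod w x))) (ListP.unfold-reverse k w) ⟩
  prod (reverse w ++ k ∷ []) (s k (prod w x))
    ≡⟨ prod-++ (reverse w) (k ∷ []) _ ⟩
  prod (reverse w) (s k (s k (prod w x)))
    ≡⟨ cong (prod (reverse w)) (s-involutive k 1≤k k<n _) ⟩
  prod (reverse w) (prod w x)
    ≡⟨ prod-reverse-inverseˡ ws x ⟩
  x ∎
  where open ≡-Reasoning

prod-reverse-inverseʳ : ∀ {n w} → IsWord n w → ∀ (x : Fin n) → prod w (prod (reverse w) x) ≡ x
prod-reverse-inverseʳ {w = []} [] x = refl
prod-reverse-inverseʳ {w = k ∷ w} ((1≤k , k<n) ∷ ws) x = begin
  s k (prod w (prod (reverse (k ∷ w)) x))
    ≡⟨ cong (λ l → s k (prod w (prod l x))) (ListP.unfold-reverse k w) ⟩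
  s k (prod w (prod (reverse w ++ k ∷ []) x))
    ≡⟨ cong (s k ∘ prod w) (prod-++ (reverse w) (k ∷ []) x) ⟩
  s k (prod w (prod (reverse w) (s k x)))
    ≡⟨ cong (s k) (prod-reverse-inverseʳ ws (s k x)) ⟩
  s k (s k x)
    ≡⟨ s-involutive k 1≤k k<n x ⟩
  x ∎
  where open ≡-Reasoning

prod-injective : ∀ {n w} → IsWord n w → Injective _≡_ _≡_ (prod {n} w)
prod-injective {w = w} ws {x} {y} e = begin
  x                              ≡⟨ prod-reverse-inverseˡ ws x ⟨
  prod (reverse w) (prod w x)    ≡⟨ cong (prod (reverse w)) e ⟩
  prod (reverse w) (prod w y)    ≡⟨ prod-reverse-inverseˡ ws y ⟩
  y                              ∎
  where open ≡-Reasoning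

prod-preimage : ∀ {n w} → IsWord n w → ∀ {m} (m<n : m < n) →
                toℕ (prod w (prod (reverse w) (fromℕ< m<n))) ≡ m
prod-preimage ws m<n = trans (cong toℕ (prod-reverse-inverseʳ ws (fromℕ< m<n))) (toℕ-fromℕ< m<n)

𝟙 : ∀ {A : Set} → Dec A → ℕ
𝟙 (yes _) = 1
𝟙 (no _)  = 0

𝟙-mono : ∀ {A B : Set} → (A → B) → (a : Dec A) (b : Dec B) → 𝟙 a ≤ 𝟙 b
𝟙-mono f (yes a) (yes b) = ℕP.≤-refl
𝟙-mono f (yes a) (no ¬b) = ⊥-elim (¬b (f a))
𝟙-mono f (no _)  _       = z≤n

𝟙-cong : ∀ {A B : Set} → (A → B) → (B → A) → (a : Dec A) (b : Dec B) → 𝟙 a ≡ 𝟙 b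
𝟙-cong f g a b = ℕP.≤-antisym (𝟙-mono f a b) (𝟙-mono g b a)

𝟙≤1 : ∀ {A : Set} (a : Dec A) → 𝟙 a ≤ 1
𝟙≤1 (yes _) = ℕP.≤-refl
𝟙≤1 (no _)  = z≤n

𝟙-step : ∀ {A B : Set} → ¬ A → B → (a : Dec A) (b : Dec B) → suc (𝟙 a) ≤ 𝟙 b
𝟙-step ¬a b (yes a) _      = ⊥-elim (¬a a)
𝟙-step ¬a b (no _) (yes _) = ℕP.≤-refl
𝟙-step ¬a b (no _) (no ¬b) = ⊥-elim (¬b b)

sum-mono-≤ : ∀ {n} {f g : Fin n → ℕ} → (∀ a → f a ≤ g a) → sum f ≤ sum g
sum-mono-≤ {zero}  f≤g = z≤n
sum-mono-≤ {suc n} f≤g = ℕP.+-mono-≤ (f≤g Fin.zero) (sum-mono-≤ (f≤g ∘ Fin.suc))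

sum-≤-suc : ∀ {n} {f g : Fin n → ℕ} a₀ → (∀ a → a ≢ a₀ → f a ≤ g a) →
            f a₀ ≤ suc (g a₀) → sum f ≤ suc (sum g)
sum-≤-suc {suc n} {f} {g} a₀ f≤g f₀≤ = begin
  sum f
    ≡⟨ sum-remove f ⟩
  f a₀ + sum (f ∘ punchIn a₀)
    ≤⟨ ℕP.+-mono-≤ f₀≤ (sum-mono-≤ (λ a → f≤g _ (punchInᵢ≢i a₀ a))) ⟩
  suc (g a₀ + sum (g ∘ punchIn a₀))
    ≡⟨ cong suc (sum-remove g) ⟨
  suc (sum g) ∎
  where open ℕP.≤-Reasoning

suc-sum-≤ : ∀ {n} {f g : Fin n → ℕ} a₀ → (∀ a → a ≢ a₀ → g a ≤ f a) →
            suc (g a₀) ≤ f a₀ → suc (sum g) ≤ sum f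
suc-sum-≤ {suc n} {f} {g} a₀ g≤f ≤f₀ = begin
  suc (sum g)
    ≡⟨ cong suc (sum-remove g) ⟩
  suc (g a₀ + sum (g ∘ punchIn a₀))
    ≤⟨ ℕP.+-mono-≤ ≤f₀ (sum-mono-≤ (λ a → g≤f _ (punchInᵢ≢i a₀ a))) ⟩
  f a₀ + sum (f ∘ punchIn a₀)
    ≡⟨ sum-remove f ⟨
  sum f ∎
  where open ℕP.≤-Reasoning

sum²-≤-suc : ∀ {m n} {f g : Fin m → Fin n → ℕ} a₀ b₀ →
             (∀ a b → ¬ (a ≡ a₀ × b ≡ b₀) → f a b ≤ g a b) →
             f a₀ b₀ ≤ suc (g a₀ b₀) → sum (sum ∘ f) ≤ suc (sum (sum ∘ g))
sum²-≤-suc a₀ b₀ f≤g f₀≤ =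
  sum-≤-suc a₀ (λ a a≢a₀ → sum-mono-≤ (λ b → f≤g a b (a≢a₀ ∘ proj₁)))
               (sum-≤-suc b₀ (λ b b≢b₀ → f≤g a₀ b (b≢b₀ ∘ proj₂)) f₀≤)

suc-sum²-≤ : ∀ {m n} {f g : Fin m → Fin n → ℕ} a₀ b₀ →
             (∀ a b → ¬ (a ≡ a₀ × b ≡ b₀) → g a b ≤ f a b) →
             suc (g a₀ b₀) ≤ f a₀ b₀ → suc (sum (sum ∘ g)) ≤ sum (sum ∘ f)
suc-sum²-≤ a₀ b₀ g≤f ≤f₀ =
  suc-sum-≤ a₀ (λ a a≢a₀ → sum-mono-≤ (λ b → g≤f a b (a≢a₀ ∘ proj₁)))
               (suc-sum-≤ b₀ (λ b b≢b₀ → g≤f a₀ b (b≢b₀ ∘ proj₂)) ≤f₀)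

Inversion : ∀ {n} → (Fin n → Fin n) → Fin n → Fin n → Set
Inversion P a b = a Fin.< b × P b Fin.< P a

inversion? : ∀ {n} (P : Fin n → Fin n) a b → Dec (Inversion P a b)
inversion? P a b = a Fin.<? b ×-dec P b Fin.<? P a

inversions : ∀ {n} → (Fin n → Fin n) → ℕ
inversions P = sum (λ a → sum (λ b → 𝟙 (inversion? P a b)))

inversions-cong : ∀ {n} {P Q : Fin n → Fin n} → (∀ x → P x ≡ Q x) → inversions P ≡ inversions Q
inversions-cong {P = P} {Q} P≗Q = sum-cong-≗ (λ a → sum-cong-≗ (λ b →
  𝟙-cong (transport P≗Q) (transport (sym ∘ P≗Q)) (inversion? P a b) (inversion? Q a b)))
  where
  transport : ∀ {P Q : Fin _ → Fin _} → (∀ x → P x ≡ Q x) →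
              ∀ {a b} → Inversion P a b → Inversion Q a b
  transport P≗Q (a<b , lt) = a<b , subst₂ Fin._<_ (P≗Q _) (P≗Q _) lt

inversions-id : ∀ {n} → inversions {n} (λ x → x) ≡ 0
inversions-id {n} =
  trans (sum-cong-≗ (λ a → trans (sum-cong-≗ (λ b → no-inversion (inversion? _ a b)))
                                 (sum-replicate-zero n)))
        (sum-replicate-zero n)
  where
  no-inversion : ∀ {a b : Fin n} (d : Dec (Inversion (λ x → x) a b)) → 𝟙 d ≡ 0
  no-inversion (yes (a<b , b<a)) = ⊥-elim (ℕP.<-asym a<b b<a)
  no-inversion (no _)            = refl

module _ {n} (P : Fin n → Fin n) (P-injective : Injective _≡_ _≡_ P)
         {j} {a₀ b₀ : Fin n} (Pa₀ : toℕ (P a₀) ≡ j) (Pb₀ : toℕ (P b₀) ≡ suc j) where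

  private
    1+j<n : suc j < n
    1+j<n = subst (_< n) Pb₀ (toℕ<n (P b₀))

    σ : Fin n → Fin n
    σ = s (suc j)

    σ-involutive : ∀ x → σ (σ x) ≡ x
    σ-involutive = s-involutive (suc j) (s≤s z≤n) 1+j<n

    σ-exchange : ∀ {a b} → Inversion (σ ∘ P) a b → Inversion P a b ⊎ (a ≡ a₀ × b ≡ b₀)
    σ-exchange (a<b , lt) with s-reflects-< (suc j) 1+j<n (P _) (P _) lt
    ... | inj₁ Pb<Pa       = inj₁ (a<b , Pb<Pa)
    ... | inj₂ (Pb≡ , Pa≡) =
          inj₂ ( P-injective (toℕ-injective (trans (ℕP.suc-injective Pa≡) (sym Pa₀)))
               , P-injective (toℕ-injective (trans Pb≡ (sym Pb₀))))

  inversions-s∘≤suc : inversions (σ ∘ P) ≤ suc (inversions P)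
  inversions-s∘≤suc = sum²-≤-suc a₀ b₀ old (ℕP.≤-trans (𝟙≤1 _) (s≤s z≤n))
    where
    old : ∀ a b → ¬ (a ≡ a₀ × b ≡ b₀) →
          𝟙 (inversion? (σ ∘ P) a b) ≤ 𝟙 (inversion? P a b)
    old a b ≢₀ = 𝟙-mono (fromInj₁ (⊥-elim ∘ ≢₀) ∘ σ-exchange) _ _

  suc-inversions≤inversions-s∘ : a₀ Fin.< b₀ → suc (inversions P) ≤ inversions (σ ∘ P)
  suc-inversions≤inversions-s∘ a₀<b₀ = suc-sum²-≤ a₀ b₀ (λ a b _ → 𝟙-mono kept _ _)
    (𝟙-step (λ (_ , lt) → ℕP.<-asym (subst₂ _<_ Pb₀ Pa₀ lt) ℕP.≤-refl) (a₀<b₀ , new) _ _)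
    where
    new : σ (P b₀) Fin.< σ (P a₀)
    new = subst₂ _<_ (sym (s-upper (suc j) (P b₀) Pb₀))
                     (sym (s-lower (suc j) 1+j<n (P a₀) (cong suc Pa₀))) ℕP.≤-refl
    kept : ∀ {a b} → Inversion P a b → Inversion (σ ∘ P) a b
    kept {a} {b} (a<b , lt)
      with s-reflects-< (suc j) 1+j<n (σ (P b)) (σ (P a))
             (subst₂ Fin._<_ (sym (σ-involutive (P b))) (sym (σ-involutive (P a))) lt)
    ... | inj₁ σPb<σPa = a<b , σPb<σPa
    ... | inj₂ (e₁ , e₂) = ⊥-elim (ℕP.<-asym a₀<b₀ (subst₂ Fin._<_ a≡b₀ b≡a₀ a<b))
      where
      b≡a₀ : b ≡ a₀
      b≡a₀ = P-injective (toℕ-injective (trans (cong toℕ (sym (σ-involutive (P b))))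
                                              (trans (s-upper (suc j) (σ (P b)) e₁) (sym Pa₀))))
      a≡b₀ : a ≡ b₀
      a≡b₀ = P-injective (toℕ-injective (trans (cong toℕ (sym (σ-involutive (P a))))
                                              (trans (s-lower (suc j) 1+j<n (σ (P a)) e₂) (sym Pb₀))))

inversions-prod≤length : ∀ {n w} → IsWord n w → inversions (prod {n} w) ≤ length w
inversions-prod≤length {n} {w = []} [] = ℕP.≤-reflexive (inversions-id {n})
inversions-prod≤length {w = suc j ∷ w} ((_ , 1+j<n) ∷ ws) =
  ℕP.≤-trans (inversions-s∘≤suc (prod w) (prod-injective ws)
                (prod-preimage ws (ℕP.<-trans (ℕP.n<1+n j) 1+j<n)) (prod-preimage ws 1+j<n))
             (s≤s (inversions-prod≤length ws))

length≤inversions⇒reduced : ∀ {n} w → length w ≤ inversions (prod {n} w) → Reduced n w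
length≤inversions⇒reduced {n} w ≤inv w′ w′-word same = begin
  length w                  ≤⟨ ≤inv ⟩
  inversions (prod {n} w)   ≡⟨ inversions-cong (sym ∘ same) ⟩
  inversions (prod {n} w′)  ≤⟨ inversions-prod≤length w′-word ⟩
  length w′                 ∎
  where open ℕP.≤-Reasoning

<ᵇ-true : ∀ {m n} → m < n → (m ℕ.<ᵇ n) ≡ true
<ᵇ-true {m} {n} m<n with m ℕ.<ᵇ n | ℕP.<⇒<ᵇ m<n
... | true | _ = refl

<ᵇ-false : ∀ {m n} → ¬ m < n → (m ℕ.<ᵇ n) ≡ false
<ᵇ-false {m} {n} m≮n with m ℕ.<ᵇ n in eq
... | false = refl
... | true  = ⊥-elim (m≮n (ℕP.<ᵇ⇒< m n (subst T (sym eq) tt)))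

filterᵇ-accept : ∀ {A : Set} (p : A → Bool) {x} xs → p x ≡ true →
                 List.filterᵇ p (x ∷ xs) ≡ x ∷ List.filterᵇ p xs
filterᵇ-accept p xs px rewrite px = refl

filterᵇ-reject : ∀ {A : Set} (p : A → Bool) {x} xs → p x ≡ false →
                 List.filterᵇ p (x ∷ xs) ≡ List.filterᵇ p xs
filterᵇ-reject p xs px rewrite px = refl

suc-length<length-++ : ∀ {A : Set} (xs : List A) y z ys →
                       suc (length xs) < length (xs ++ y ∷ z ∷ ys)
suc-length<length-++ []       y z ys = s≤s (s≤s z≤n)
suc-length<length-++ (x ∷ xs) y z ys = s≤s (suc-length<length-++ xs y z ys)

_‼_ : List ℕ → ℕ → ℕ
[]       ‼ p     = 0
(x ∷ xs) ‼ zero  = x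
(x ∷ xs) ‼ suc p = xs ‼ p

‼-++ˡ : ∀ (xs ys : List ℕ) {p} → p < length xs → (xs ++ ys) ‼ p ≡ xs ‼ p
‼-++ˡ (x ∷ xs) ys {zero}  _   = refl
‼-++ˡ (x ∷ xs) ys {suc p} p<l = ‼-++ˡ xs ys (ℕ.s<s⁻¹ p<l)

‼-++-length : ∀ (xs : List ℕ) y ys → (xs ++ y ∷ ys) ‼ length xs ≡ y
‼-++-length []       y ys = refl
‼-++-length (x ∷ xs) y ys = ‼-++-length xs y ys

‼-++-suc-length : ∀ (xs : List ℕ) y z ys → (xs ++ y ∷ z ∷ ys) ‼ suc (length xs) ≡ z
‼-++-suc-length []       y z ys = refl
‼-++-suc-length (x ∷ xs) y z ys = ‼-++-suc-length xs y z ys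

‼-++-away : ∀ (xs : List ℕ) y z y′ z′ ys {p} → p ≢ length xs → p ≢ suc (length xs) →
            (xs ++ y ∷ z ∷ ys) ‼ p ≡ (xs ++ y′ ∷ z′ ∷ ys) ‼ p
‼-++-away []       y z y′ z′ ys {zero}        p≢ _  = ⊥-elim (p≢ refl)
‼-++-away []       y z y′ z′ ys {suc zero}    _  p≢ = ⊥-elim (p≢ refl)
‼-++-away []       y z y′ z′ ys {suc (suc p)} _  _  = refl
‼-++-away (x ∷ xs) y z y′ z′ ys {zero}        _  _  = refl
‼-++-away (x ∷ xs) y z y′ z′ ys {suc p}       p≢ p≢′ =
  ‼-++-away xs y z y′ z′ ys (p≢ ∘ cong suc) (p≢′ ∘ cong suc)

‼-applyUpTo : ∀ (f : ℕ → ℕ) {m p} → p < m → List.applyUpTo f m ‼ p ≡ f p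
‼-applyUpTo f {suc m} {zero}  _   = refl
‼-applyUpTo f {suc m} {suc p} p<m = ‼-applyUpTo (f ∘ suc) (ℕ.s<s⁻¹ p<m)

‼-downFrom : ∀ {m p} → p < m → List.downFrom m ‼ p ≡ m ∸ suc p
‼-downFrom {suc m} {zero}  _   = refl
‼-downFrom {suc m} {suc p} p<m = ‼-downFrom (ℕ.s<s⁻¹ p<m)

applyDownFrom-+-∷ʳ : ∀ c d →
                     List.applyDownFrom (c +_) (suc d) ≡ List.applyDownFrom (suc c +_) d ++ c ∷ []
applyDownFrom-+-∷ʳ c zero    = cong (_∷ []) (ℕP.+-identityʳ c)
applyDownFrom-+-∷ʳ c (suc d) = cong₂ _∷_ (ℕP.+-suc c d) (applyDownFrom-+-∷ʳ c d)

downFrom-+ : ∀ d c → List.downFrom (d + c) ≡ List.applyDownFrom (c +_) d ++ List.downFrom c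
downFrom-+ zero    c = refl
downFrom-+ (suc d) c = cong₂ _∷_ (ℕP.+-comm d c) (downFrom-+ d c)

pick : (ℕ → Bool) → (ℕ → ℕ) → List ℕ → List ℕ
pick p f = List.map f ∘ List.filterᵇ p

pick-accept : ∀ p f {x} xs → p x ≡ true → pick p f (x ∷ xs) ≡ f x ∷ pick p f xs
pick-accept p f xs px = cong (List.map f) (filterᵇ-accept p xs px)

pick-reject : ∀ p f {x} xs → p x ≡ false → pick p f (x ∷ xs) ≡ pick p f xs
pick-reject p f xs px = cong (List.map f) (filterᵇ-reject p xs px)

pick-++ : ∀ p f xs ys → pick p f (xs ++ ys) ≡ pick p f xs ++ pick p f ys
pick-++ p f xs ys = trans (cong (List.map f) (ListP.filter-++ (T? ∘ p) xs ys))
                          (ListP.map-++ f (List.filterᵇ p xs) (List.filterᵇ p ys))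

pick-cong : ∀ {p q f g} xs → (∀ {j} → j ∈ xs → p j ≡ q j) →
            (∀ {j} → j ∈ xs → p j ≡ true → f j ≡ g j) → pick p f xs ≡ pick q g xs
pick-cong [] _ _ = refl
pick-cong {p} {q} {f} {g} (x ∷ xs) p≡q f≡g with p x in px
... | true  = begin
  f x ∷ pick p f xs   ≡⟨ cong₂ _∷_ (f≡g (here refl) px) (pick-cong xs (p≡q ∘ there) (f≡g ∘ there)) ⟩
  g x ∷ pick q g xs   ≡⟨ pick-accept q g xs (trans (sym (p≡q (here refl))) px) ⟨
  pick q g (x ∷ xs)   ∎
  where open ≡-Reasoning
... | false = begin
  pick p f xs         ≡⟨ pick-cong xs (p≡q ∘ there) (f≡g ∘ there) ⟩
  pick q g xs         ≡⟨ pick-reject q g xs (trans (sym (p≡q (here refl))) px) ⟨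
  pick q g (x ∷ xs)   ∎
  where open ≡-Reasoning

‼-s : ∀ {n} A (f g : ℕ) G → suc (length A) < n → (q : Fin n) →
      (A ++ g ∷ f ∷ G) ‼ toℕ (s (suc (length A)) q) ≡ (A ++ f ∷ g ∷ G) ‼ toℕ q
‼-s A f g G k<n q = by-view (s-view k k<n q)
  where
  open ≡-Reasoning
  k = suc (length A)
  swapped = A ++ g ∷ f ∷ G
  original = A ++ f ∷ g ∷ G
  by-view : SView k q → swapped ‼ toℕ (s k q) ≡ original ‼ toℕ q
  by-view (lower e₁ e₂) = begin
    swapped ‼ toℕ (s k q)     ≡⟨ cong (swapped ‼_) e₂ ⟩
    swapped ‼ suc (length A)  ≡⟨ ‼-++-suc-length A g f G ⟩
    f                         ≡⟨ ‼-++-length A f (g ∷ G) ⟨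
    original ‼ length A       ≡⟨ cong (original ‼_) (ℕP.suc-injective e₁) ⟨
    original ‼ toℕ q          ∎
  by-view (upper e₁ e₂) = begin
    swapped ‼ toℕ (s k q)     ≡⟨ cong (swapped ‼_) e₂ ⟩
    swapped ‼ length A        ≡⟨ ‼-++-length A g (f ∷ G) ⟩
    g                         ≡⟨ ‼-++-suc-length A f g G ⟨
    original ‼ suc (length A) ≡⟨ cong (original ‼_) e₁ ⟨
    original ‼ toℕ q          ∎
  by-view (fixed e₁ e₂ e₃) =
    trans (cong (λ x → swapped ‼ toℕ x) e₃) (‼-++-away A g f f g G (e₁ ∘ cong suc) e₂)

tabulate-∘toℕ : ∀ {A : Set} (f : ℕ → A) n → List.tabulate (f ∘ toℕ {n}) ≡ List.applyUpTo f n
tabulate-∘toℕ f zero    = refl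
tabulate-∘toℕ f (suc n) = cong (f 0 ∷_) (tabulate-∘toℕ (f ∘ suc) n)

toℕ-reverse-allFin : ∀ n → List.map toℕ (reverse (List.allFin n)) ≡ List.downFrom n
toℕ-reverse-allFin n = begin
  List.map toℕ (reverse (List.allFin n))   ≡⟨ ListP.reverse-map toℕ (List.allFin n) ⟩
  reverse (List.map toℕ (List.allFin n))   ≡⟨ cong reverse (ListP.map-tabulate {n = n} (λ i → i) toℕ) ⟩
  reverse (List.tabulate {n = n} toℕ)      ≡⟨ cong reverse (tabulate-∘toℕ (λ i → i) n) ⟩
  reverse (List.upTo n)                    ≡⟨ ListP.reverse-upTo n ⟩
  List.downFrom n                          ∎
  where open ≡-Reasoning

w₀-injective : ∀ {n} → Injective _≡_ _≡_ (w₀ {n})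
w₀-injective {x = a} {b} e =
  trans (sym (FinP.opposite-involutive a)) (trans (cong Fin.opposite e) (FinP.opposite-involutive b))

extend : ∀ {n} {A : Set} → A → (Fin n → A) → ℕ → A
extend {n} a f m with m ℕ.<? n
... | yes m<n = f (fromℕ< m<n)
... | no _    = a

extend-fromℕ< : ∀ {n} {A : Set} (a : A) (f : Fin n → A) {m} (m<n : m < n) →
                extend a f m ≡ f (fromℕ< m<n)
extend-fromℕ< {n} a f {m} m<n with m ℕ.<? n
... | yes m<n′ = cong f (toℕ-injective (trans (toℕ-fromℕ< m<n′) (sym (toℕ-fromℕ< m<n))))
... | no m≮n  = ⊥-elim (m≮n m<n)

extend-toℕ : ∀ {n} {A : Set} (a : A) (f : Fin n → A) (x : Fin n) → extend a f (toℕ x) ≡ f x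
extend-toℕ a f x = trans (extend-fromℕ< a f (toℕ<n x)) (cong f (FinP.fromℕ<-toℕ x (toℕ<n x)))

entryLabel : Dir → (fromTop fromLeft : ℕ) → ℕ
entryLabel fromTop  a b = a
entryLabel fromLeft a b = b

exitLabel : Tile → Out → (fromTop fromLeft : ℕ) → ℕ
exitLabel hpipe goRight a b = b
exitLabel vpipe goDown  a b = a
exitLabel pivot goRight a b = a
exitLabel cross goRight a b = b
exitLabel cross goDown  a b = a
exitLabel elbow goRight a b = a
exitLabel elbow goDown  a b = b
exitLabel _     _       _ _ = 0

exitLabel-route : ∀ t d o a b → route t d ≡ just o → exitLabel t o a b ≡ entryLabel d a b
exitLabel-route hpipe fromLeft _ a b refl = refl
exitLabel-route vpipe fromTop  _ a b refl = refl
exitLabel-route pivot fromTop  _ a b refl = refl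
exitLabel-route cross fromTop  _ a b refl = refl
exitLabel-route cross fromLeft _ a b refl = refl
exitLabel-route elbow fromTop  _ a b refl = refl
exitLabel-route elbow fromLeft _ a b refl = refl
exitLabel-route empty fromTop  _ a b ()
exitLabel-route empty fromLeft _ a b ()
exitLabel-route hpipe fromTop  _ a b ()
exitLabel-route vpipe fromLeft _ a b ()
exitLabel-route pivot fromLeft _ a b ()

cross-routes : ∀ {t} → t ≡ cross → ∀ d → route t d ≢ nothing
cross-routes refl fromTop  ()
cross-routes refl fromLeft ()

next-suc : ∀ {n} (j j′ : Fin n) → next j ≡ just j′ → toℕ j′ ≡ suc (toℕ j)
next-suc {n} j j′ eq with suc (toℕ j) ℕ.<? n
next-suc j j′ refl | yes 1+j<n = toℕ-fromℕ< 1+j<n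

next-last : ∀ {n} (j : Fin n) → next j ≡ nothing → toℕ j ≡ n ∸ 1
next-last {n} j eq with suc (toℕ j) ℕ.<? n
next-last j () | yes _
next-last j eq | no 1+j≮n = cong (_∸ 1) (ℕP.≤∧≮⇒≡ (toℕ<n j) 1+j≮n)

module PipeLabels {n} (D : Tiling n) where

  tile : ℕ → ℕ → Tile
  tile r c = extend empty (λ i → extend empty (D i) c) r

  tile-toℕ : ∀ i j → tile (toℕ i) (toℕ j) ≡ D i j
  tile-toℕ i j =
    trans (extend-toℕ empty (λ i → extend empty (D i) (toℕ j)) i) (extend-toℕ empty (D i) j)

  tile-fromℕ< : ∀ {r c} (r<n : r < n) (c<n : c < n) → tile r c ≡ D (fromℕ< r<n) (fromℕ< c<n)
  tile-fromℕ< r<n c<n =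
    trans (cong₂ tile (sym (toℕ-fromℕ< r<n)) (sym (toℕ-fromℕ< c<n)))
          (tile-toℕ (fromℕ< r<n) (fromℕ< c<n))

  -- The label of the pipe entering box (r , c) from the top, resp. from the left,
  -- propagated from the labels of the columns; 0 where no pipe enters.
  mutual
    top : ℕ → ℕ → ℕ
    top zero    c = c
    top (suc r) c = down r c

    left : ℕ → ℕ → ℕ
    left r zero    = 0
    left r (suc c) = right r c

    down : ℕ → ℕ → ℕ
    down r c = exitLabel (tile r c) goDown (top r c) (left r c)

    right : ℕ → ℕ → ℕ
    right r c = exitLabel (tile r c) goRight (top r c) (left r c)

  label : Fin n → Fin n → Dir → ℕ
  label i j d = entryLabel d (top (toℕ i) (toℕ j)) (left (toℕ i) (toℕ j))

  rowExit : ℕ → ℕ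
  rowExit r = right r (n ∸ 1)

  route-label : ∀ i j d o → route (D i j) d ≡ just o →
                exitLabel (tile (toℕ i) (toℕ j)) o (top (toℕ i) (toℕ j)) (left (toℕ i) (toℕ j))
                ≡ label i j d
  route-label i j d o eq rewrite tile-toℕ i j = exitLabel-route (D i j) d o _ _ eq

  LabelledBy : ℕ → List (Visit n) × End n → Set
  LabelledBy k (vs , e) = (∀ {i j d} → (i , j , d) ∈ vs → label i j d ≡ k)
                        × (∀ r → e ≡ rightEdge r → rowExit (toℕ r) ≡ k)

  relabel : ∀ {k k′} t → k ≡ k′ → LabelledBy k t → LabelledBy k′ t
  relabel t refl l = l

  visit-labelled : ∀ {i j d vs e} → LabelledBy (label i j d) (vs , e) →
                   LabelledBy (label i j d) ((i , j , d) ∷ vs , e)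
  visit-labelled (visits , exits) = (λ { (here refl) → refl ; (there v) → visits v }) , exits

  walk-labelled : ∀ f i j d → LabelledBy (label i j d) (walk D f i j d)
  walk-labelled zero i j d = (λ ()) , (λ _ ())
  walk-labelled (suc f) i j d with route (D i j) d in eq
  ... | nothing = (λ ()) , (λ _ ())
  ... | just goRight with next j in eqn
  ...   | nothing = visit-labelled ((λ ()) , λ { r refl → exit })
    where
    exit : rowExit (toℕ i) ≡ label i j d
    exit = trans (cong (right (toℕ i)) (sym (next-last j eqn))) (route-label i j d goRight eq)
  ...   | just j′ with walk D f i j′ fromLeft | walk-labelled f i j′ fromLeft
  ...     | (vs , e) | ih = visit-labelled (relabel (vs , e) step ih)
    where
    step : label i j′ fromLeft ≡ label i j d
    step = trans (cong (left (toℕ i)) (next-suc j j′ eqn)) (route-label i j d goRight eq)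
  walk-labelled (suc f) i j d | just goDown with next i in eqn
  ...   | nothing = visit-labelled ((λ ()) , (λ _ ()))
  ...   | just i′ with walk D f i′ j fromTop | walk-labelled f i′ j fromTop
  ...     | (vs , e) | ih = visit-labelled (relabel (vs , e) step ih)
    where
    step : label i′ j fromTop ≡ label i j d
    step = trans (cong (λ r → top r (toℕ j)) (next-suc i i′ eqn)) (route-label i j d goDown eq)

pipe-labelled : ∀ {n} (D : Tiling n) k → PipeLabels.LabelledBy D (toℕ k) (pipe D k)
pipe-labelled {suc m} D k = PipeLabels.walk-labelled D (suc m + suc m) Fin.zero k fromTop

module Sweep {n} (u v : Permutation′ n) (D : Tiling n) (fpp : IsFPP u v D) where
  open PipeLabels D
  open IsFPP fpp
  open RothePD rothePD

  u⁺ u⁻ : ℕ → ℕ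
  u⁺ = extend 0 (λ i → toℕ (u ⟨$⟩ʳ i))
  u⁻ = extend 0 (λ j → toℕ (u ⟨$⟩ˡ j))

  inRothe : ℕ → ℕ → Bool
  inRothe i c = (u⁺ i ℕ.<ᵇ c) ∧ (i ℕ.<ᵇ u⁻ c)

  -- Whether a pipe enters box (i , c) from the top.
  live : ℕ → ℕ → Bool
  live i c = i ℕ.<ᵇ suc (u⁻ c)

  u⁺-fromℕ< : ∀ {i} (i<n : i < n) → toℕ (u ⟨$⟩ʳ fromℕ< i<n) ≡ u⁺ i
  u⁺-fromℕ< i<n = sym (extend-fromℕ< 0 (λ i → toℕ (u ⟨$⟩ʳ i)) i<n)

  u⁻-fromℕ< : ∀ {c} (c<n : c < n) → toℕ (u ⟨$⟩ˡ fromℕ< c<n) ≡ u⁻ c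
  u⁻-fromℕ< c<n = sym (extend-fromℕ< 0 (λ j → toℕ (u ⟨$⟩ˡ j)) c<n)

  u⁺<n : ∀ {i} → i < n → u⁺ i < n
  u⁺<n i<n = subst (_< n) (u⁺-fromℕ< i<n) (toℕ<n _)

  u⁻-u⁺ : ∀ {i} → i < n → u⁻ (u⁺ i) ≡ i
  u⁻-u⁺ {i} i<n = begin
    u⁻ (u⁺ i)                         ≡⟨ cong u⁻ (u⁺-fromℕ< i<n) ⟨
    u⁻ (toℕ (u ⟨$⟩ʳ fromℕ< i<n))      ≡⟨ extend-toℕ 0 (λ j → toℕ (u ⟨$⟩ˡ j)) _ ⟩
    toℕ (u ⟨$⟩ˡ (u ⟨$⟩ʳ fromℕ< i<n))  ≡⟨ cong toℕ (inverseˡ u) ⟩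
    toℕ (fromℕ< i<n)                  ≡⟨ toℕ-fromℕ< i<n ⟩
    i                                 ∎
    where open ≡-Reasoning

  u⁻≡⇒≡u⁺ : ∀ {i c} → i < n → c < n → u⁻ c ≡ i → c ≡ u⁺ i
  u⁻≡⇒≡u⁺ {i} {c} i<n c<n e = begin
    c                                 ≡⟨ toℕ-fromℕ< c<n ⟨
    toℕ (fromℕ< c<n)                  ≡⟨ cong toℕ (inverseʳ u) ⟨
    toℕ (u ⟨$⟩ʳ (u ⟨$⟩ˡ fromℕ< c<n))  ≡⟨ cong (λ x → toℕ (u ⟨$⟩ʳ x)) u⁻¹c≡i ⟩
    toℕ (u ⟨$⟩ʳ fromℕ< i<n)           ≡⟨ u⁺-fromℕ< i<n ⟩
    u⁺ i                              ∎
    where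
    open ≡-Reasoning
    u⁻¹c≡i : u ⟨$⟩ˡ fromℕ< c<n ≡ fromℕ< i<n
    u⁻¹c≡i = toℕ-injective (trans (u⁻-fromℕ< c<n) (trans e (sym (toℕ-fromℕ< i<n))))
  data BoxType (r c : ℕ) : Set where
    emptyBox : c < u⁺ r → live r c ≡ false → live (suc r) c ≡ false → BoxType r c
    vpipeBox : c < u⁺ r → live r c ≡ true → live (suc r) c ≡ true →
               tile r c ≡ vpipe → BoxType r c
    pivotBox : c ≡ u⁺ r → live r c ≡ true → live (suc r) c ≡ false →
               tile r c ≡ pivot → BoxType r c
    hpipeBox : u⁺ r < c → inRothe r c ≡ false → live r c ≡ false → live (suc r) c ≡ false →
               tile r c ≡ hpipe → BoxType r c
    rotheBox : u⁺ r < c → inRothe r c ≡ true → live r c ≡ true → live (suc r) c ≡ true →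
               tile r c ≡ cross ⊎ tile r c ≡ elbow → BoxType r c

  boxType : ∀ {r c} → r < n → c < n → BoxType r c
  boxType {r} {c} r<n c<n = classify (ℕP.<-cmp c (u⁺ r)) (ℕP.<-cmp (u⁻ c) r)
    where
    i = fromℕ< r<n
    j = fromℕ< c<n
    ⟨r⟩ : toℕ i ≡ r
    ⟨r⟩ = toℕ-fromℕ< r<n
    ⟨c⟩ : toℕ j ≡ c
    ⟨c⟩ = toℕ-fromℕ< c<n
    ⟨u⁺⟩ : toℕ (u ⟨$⟩ʳ i) ≡ u⁺ r
    ⟨u⁺⟩ = u⁺-fromℕ< r<n
    ⟨u⁻⟩ : toℕ (u ⟨$⟩ˡ j) ≡ u⁻ c
    ⟨u⁻⟩ = u⁻-fromℕ< c<n
    ⟨tile⟩ : tile r c ≡ D i j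
    ⟨tile⟩ = tile-fromℕ< r<n c<n
    alive : ∀ {r′} → r′ ≤ u⁻ c → live r′ c ≡ true
    alive r′≤ = <ᵇ-true (s≤s r′≤)
    dead : ∀ {r′} → u⁻ c < r′ → live r′ c ≡ false
    dead u⁻<r′ = <ᵇ-false (λ lt → ℕP.<⇒≱ u⁻<r′ (ℕP.m<1+n⇒m≤n lt))

    classify : Tri (c < u⁺ r) (c ≡ u⁺ r) (u⁺ r < c) → Tri (u⁻ c < r) (u⁻ c ≡ r) (r < u⁻ c) →
               BoxType r c
    classify (tri≈ _ c≡u _) _ =
      pivotBox c≡u (alive (ℕP.≤-reflexive (sym u⁻c≡r))) (dead (ℕP.≤-reflexive (cong suc u⁻c≡r)))
               (trans ⟨tile⟩ (trans (cong (D i) j≡ui) (pivots i)))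
      where
      u⁻c≡r : u⁻ c ≡ r
      u⁻c≡r = trans (cong u⁻ c≡u) (u⁻-u⁺ r<n)
      j≡ui : j ≡ u ⟨$⟩ʳ i
      j≡ui = toℕ-injective (trans ⟨c⟩ (trans c≡u (sym ⟨u⁺⟩)))
    classify (tri< c<u _ _) (tri< u⁻<r _ _) = emptyBox c<u (dead u⁻<r) (dead (ℕP.m<n⇒m<1+n u⁻<r))
    classify (tri< c<u _ _) (tri≈ _ u⁻≡r _) =
      ⊥-elim (ℕP.<-irrefl (u⁻≡⇒≡u⁺ r<n c<n u⁻≡r) c<u)
    classify (tri< c<u _ _) (tri> _ _ r<u⁻) =
      vpipeBox c<u (alive (ℕP.<⇒≤ r<u⁻)) (alive r<u⁻)
               (trans ⟨tile⟩ (vpipes i j (subst₂ _<_ (sym ⟨r⟩) (sym ⟨u⁻⟩) r<u⁻)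
                                         (subst₂ _<_ (sym ⟨c⟩) (sym ⟨u⁺⟩) c<u)))
    classify (tri> _ _ u<c) (tri< u⁻<r _ _) =
      hpipeBox u<c (trans (cong ((u⁺ r ℕ.<ᵇ c) ∧_) (<ᵇ-false (ℕP.<-asym u⁻<r))) (∧-zeroʳ _))
               (dead u⁻<r) (dead (ℕP.m<n⇒m<1+n u⁻<r))
               (trans ⟨tile⟩ (hpipes i j (subst₂ _<_ (sym ⟨u⁻⟩) (sym ⟨r⟩) u⁻<r)
                                         (subst₂ _<_ (sym ⟨u⁺⟩) (sym ⟨c⟩) u<c)))
    classify (tri> _ _ u<c) (tri≈ _ u⁻≡r _) =
      ⊥-elim (ℕP.<-irrefl (sym (u⁻≡⇒≡u⁺ r<n c<n u⁻≡r)) u<c)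
    classify (tri> _ _ u<c) (tri> _ _ r<u⁻) =
      rotheBox u<c (cong₂ _∧_ (<ᵇ-true u<c) (<ᵇ-true r<u⁻)) (alive (ℕP.<⇒≤ r<u⁻)) (alive r<u⁻)
               (Sum.map (trans ⟨tile⟩) (trans ⟨tile⟩)
                 (rothe i j ( subst₂ _<_ (sym ⟨u⁺⟩) (sym ⟨c⟩) u<c
                            , subst₂ _<_ (sym ⟨r⟩) (sym ⟨u⁻⟩) r<u⁻)))

  -- ℓ lists the labels of the pipes leaving the scanned region, read clockwise along its
  -- boundary from the top right corner.
  record Invariant (Scanned : Fin n → Fin n → Set) (w ℓ : List ℕ) : Set where
    field
      frontier-length    : length ℓ ≡ n
      word               : IsWord n w
      frontier           : ∀ (x : Fin n) → ℓ ‼ toℕ (prod w x) ≡ toℕ (w₀ x)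
      length≤inversions  : length w ≤ inversions (prod {n} w)
      inversions-crossed : ∀ (x y : Fin n) → x Fin.< y → prod w y Fin.< prod w x →
                           ∃[ i ] ∃[ j ] Scanned i j × CrossAt D (w₀ x) (w₀ y) i j

  invariant-mono : ∀ {S S′ w ℓ} → (∀ {i j} → S i j → S′ i j) →
                   Invariant S w ℓ → Invariant S′ w ℓ
  invariant-mono S⊆S′ I = record
    { frontier-length    = frontier-length
    ; word               = word
    ; frontier           = frontier
    ; length≤inversions  = length≤inversions
    ; inversions-crossed = λ x y x<y lt →
        let (i , j , scanned , crossing) = inversions-crossed x y x<y lt in i , j , S⊆S′ scanned , crossing
    }
    where open Invariant I

  passes-labelled : ∀ {i j d} → route (D i j) d ≢ nothing →
                    ∀ p → toℕ p ≡ label i j d → Passes D p i j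
  passes-labelled {i} {j} {d} routed p p≡ with covered i j d routed
  ... | q , visit = d , subst (λ q → (i , j , d) ∈ pathOf D q) (sym p≡q) visit
    where
    p≡q : p ≡ q
    p≡q = toℕ-injective (trans p≡ (proj₁ (pipe-labelled D q) visit))

  crossing-uninverted : ∀ {S w ℓ a b i j} → Invariant S w ℓ → ¬ S i j → a ≢ b →
                        CrossAt D (w₀ a) (w₀ b) i j → prod w a Fin.< prod w b → a Fin.< b
  crossing-uninverted {a = a} {b} {i} {j} I unscanned a≢b (isCross , pa , pb) Pa<Pb
    with ℕP.<-cmp (toℕ a) (toℕ b)
  ... | tri< a<b _ _ = a<b
  ... | tri≈ _ a≡b _ = ⊥-elim (a≢b (toℕ-injective a≡b))
  ... | tri> _ _ b<a with Invariant.inversions-crossed I b a b<a Pa<Pb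
  ...   | i′ , j′ , scanned , crossing
          with reduced (w₀ b) (w₀ a) (a≢b ∘ sym ∘ w₀-injective) i′ j′ i j
                       crossing (isCross , pb , pa)
  ...     | refl , refl = ⊥-elim (unscanned scanned)

  cross-step : ∀ {S S′ w} A f g G (i j : Fin n) → D i j ≡ cross →
               ¬ S i j → S′ i j → (∀ {a b} → S a b → S′ a b) →
               f ≡ label i j fromTop → g ≡ label i j fromLeft →
               Invariant S w (A ++ f ∷ g ∷ G) → Invariant S′ (suc (length A) ∷ w) (A ++ g ∷ f ∷ G)
  cross-step {S} {S′} {w} A f g G i j isCross unscanned scanned S⊆S′ f≡ g≡ I = record
    { frontier-length    = trans (ListP.length-++ A) (trans (sym (ListP.length-++ A)) frontier-length)
    ; word               = (s≤s z≤n , k<n) ∷ word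
    ; frontier           = λ x → trans (‼-s A f g G k<n (prod w x)) (frontier x)
    ; length≤inversions  = ℕP.≤-trans (s≤s length≤inversions)
                             (suc-inversions≤inversions-s∘ (prod w) (prod-injective word) Pa₀ Pb₀
                               (crossing-uninverted I unscanned a₀≢b₀ crossing Pa₀<Pb₀))
    ; inversions-crossed = crossed
    }
    where
    open Invariant I
    k<n : suc (length A) < n
    k<n = subst (suc (length A) <_) frontier-length (suc-length<length-++ A f g G)
    A<n : length A < n
    A<n = ℕP.<-trans (ℕP.n<1+n _) k<n
    a₀ b₀ : Fin n
    a₀ = prod (reverse w) (fromℕ< A<n)
    b₀ = prod (reverse w) (fromℕ< k<n)
    Pa₀ : toℕ (prod w a₀) ≡ length A
    Pa₀ = prod-preimage word A<n
    Pb₀ : toℕ (prod w b₀) ≡ suc (length A)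
    Pb₀ = prod-preimage word k<n
    Pa₀<Pb₀ : prod w a₀ Fin.< prod w b₀
    Pa₀<Pb₀ = subst₂ _<_ (sym Pa₀) (sym Pb₀) (ℕP.n<1+n _)
    a₀≢b₀ : a₀ ≢ b₀
    a₀≢b₀ e = ℕP.<-irrefl (cong (toℕ ∘ prod w) e) Pa₀<Pb₀
    f≡a₀ : f ≡ toℕ (w₀ a₀)
    f≡a₀ = trans (sym (‼-++-length A f (g ∷ G)))
                 (trans (cong ((A ++ f ∷ g ∷ G) ‼_) (sym Pa₀)) (frontier a₀))
    g≡b₀ : g ≡ toℕ (w₀ b₀)
    g≡b₀ = trans (sym (‼-++-suc-length A f g G))
                 (trans (cong ((A ++ f ∷ g ∷ G) ‼_) (sym Pb₀)) (frontier b₀))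
    crossing : CrossAt D (w₀ a₀) (w₀ b₀) i j
    crossing = isCross
             , passes-labelled (cross-routes isCross fromTop) (w₀ a₀) (trans (sym f≡a₀) f≡)
             , passes-labelled (cross-routes isCross fromLeft) (w₀ b₀) (trans (sym g≡b₀) g≡)
    crossed : ∀ (x y : Fin n) → x Fin.< y → prod (suc (length A) ∷ w) y Fin.< prod (suc (length A) ∷ w) x →
              ∃[ i′ ] ∃[ j′ ] S′ i′ j′ × CrossAt D (w₀ x) (w₀ y) i′ j′
    crossed x y x<y lt with s-reflects-< (suc (length A)) k<n (prod w y) (prod w x) lt
    ... | inj₁ lt′ = let (i′ , j′ , scanned′ , crossing′) = inversions-crossed x y x<y lt′
                     in i′ , j′ , S⊆S′ scanned′ , crossing′
    ... | inj₂ (Py≡ , Px≡) =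
          i , j , scanned , subst₂ (λ a b → CrossAt D (w₀ a) (w₀ b) i j) (sym x≡a₀) (sym y≡b₀)
                                   crossing
      where
      x≡a₀ : x ≡ a₀
      x≡a₀ = prod-injective word (toℕ-injective (trans (ℕP.suc-injective Px≡) (sym Pa₀)))
      y≡b₀ : y ≡ b₀
      y≡b₀ = prod-injective word (toℕ-injective (trans Py≡ (sym Pb₀)))

  ScannedBefore : ℕ → ℕ → Fin n → Fin n → Set
  ScannedBefore i c a b = toℕ a < i ⊎ (toℕ a ≡ i × toℕ b < c)

  next-column : ∀ {i c a b} → ScannedBefore i c a b → ScannedBefore i (suc c) a b
  next-column (inj₁ a<i)         = inj₁ a<i
  next-column (inj₂ (a≡i , b<c)) = inj₂ (a≡i , ℕP.m<n⇒m<1+n b<c)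

  exitsAbove : ℕ → List ℕ
  exitsAbove = List.applyUpTo rowExit

  rowFrontier : ℕ → List ℕ
  rowFrontier i = exitsAbove i ++ pick (live i) (top i) (List.downFrom n)

  -- The frontier while row i is scanned up to column c, where d = n ∸ c: the exits of the rows
  -- above, the pipes yet to enter row i at its Rothe boxes, the pipe running along row i, and
  -- the pipes that have left row i downwards.
  awaiting : ℕ → ℕ → ℕ → List ℕ
  awaiting i d c = pick (inRothe i) (top i) (List.applyDownFrom (c +_) d)

  passedDown : ℕ → ℕ → List ℕ
  passedDown i c = pick (live (suc i)) (down i) (List.downFrom c)

  scanFrontier : ℕ → ℕ → ℕ → List ℕ
  scanFrontier i d c = exitsAbove i ++ awaiting i d c ++ left i c ∷ passedDown i c

  -- h is the rank, counted from the right, of the next Rothe box of row i.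
  rowWord : ℕ → ℕ → List ℕ → List ℕ
  rowWord i h []       = []
  rowWord i h (c ∷ cs) = if inRothe i c
                         then (if isCross (tile i c) then i + h ∷ rowWord i (suc h) cs else rowWord i (suc h) cs)
                         else rowWord i h cs

  scanWord : ℕ → ℕ → ℕ → List ℕ
  scanWord i d c = rowWord i (suc (length (awaiting i d c))) (List.downFrom c)

  RowState : ℕ → ℕ → ℕ → List ℕ → Set
  RowState i d c w = Invariant (ScannedBefore i c) (scanWord i d c ++ w) (scanFrontier i d c)

  right-tile : ∀ {r c t} → tile r c ≡ t → right r c ≡ exitLabel t goRight (top r c) (left r c)
  right-tile eq = cong (λ t → exitLabel t goRight _ _) eq

  down-tile : ∀ {r c t} → tile r c ≡ t → down r c ≡ exitLabel t goDown (top r c) (left r c)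
  down-tile eq = cong (λ t → exitLabel t goDown _ _) eq

  awaiting-∷ʳ : ∀ i d c →
                awaiting i (suc d) c ≡ awaiting i d (suc c) ++ pick (inRothe i) (top i) (c ∷ [])
  awaiting-∷ʳ i d c = trans (cong (pick (inRothe i) (top i)) (applyDownFrom-+-∷ʳ c d))
                            (pick-++ (inRothe i) (top i) (List.applyDownFrom (suc c +_) d) (c ∷ []))

  awaiting-reject : ∀ {i d c} → inRothe i c ≡ false → awaiting i (suc d) c ≡ awaiting i d (suc c)
  awaiting-reject {i} {d} {c} out =
    trans (awaiting-∷ʳ i d c)
          (trans (cong (awaiting i d (suc c) ++_) (pick-reject (inRothe i) (top i) [] out))
                 (ListP.++-identityʳ _))

  awaiting-accept : ∀ {i d c} → inRothe i c ≡ true →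
                    awaiting i (suc d) c ≡ awaiting i d (suc c) ++ top i c ∷ []
  awaiting-accept {i} {d} {c} isR =
    trans (awaiting-∷ʳ i d c) (cong (awaiting i d (suc c) ++_) (pick-accept (inRothe i) (top i) [] isR))

  length-awaiting-accept : ∀ {i d c} → inRothe i c ≡ true →
                           length (awaiting i (suc d) c) ≡ suc (length (awaiting i d (suc c)))
  length-awaiting-accept {i} {d} {c} isR =
    trans (cong length (awaiting-accept isR))
          (trans (ListP.length-++ (awaiting i d (suc c))) (ℕP.+-comm _ 1))

  passedDown-accept : ∀ {i c} → live (suc i) c ≡ true →
                      passedDown i (suc c) ≡ down i c ∷ passedDown i c
  passedDown-accept {i} {c} = pick-accept (live (suc i)) (down i) (List.downFrom c)

  passedDown-reject : ∀ {i c} → live (suc i) c ≡ false → passedDown i (suc c) ≡ passedDown i c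
  passedDown-reject {i} {c} = pick-reject (live (suc i)) (down i) (List.downFrom c)

  rowWord-reject : ∀ {i h c} cs → inRothe i c ≡ false → rowWord i h (c ∷ cs) ≡ rowWord i h cs
  rowWord-reject cs out rewrite out = refl

  rowWord-uncrossed : ∀ {i h c} cs → inRothe i c ≡ true → isCross (tile i c) ≡ false →
                      rowWord i h (c ∷ cs) ≡ rowWord i (suc h) cs
  rowWord-uncrossed cs isR uncrossed rewrite isR | uncrossed = refl

  rowWord-crossed : ∀ {i h c} cs → inRothe i c ≡ true → isCross (tile i c) ≡ true →
                    rowWord i h (c ∷ cs) ≡ i + h ∷ rowWord i (suc h) cs
  rowWord-crossed cs isR crossed rewrite isR | crossed = refl

  rowWord-none : ∀ {i h} cs → (∀ {j} → j ∈ cs → inRothe i j ≡ false) → rowWord i h cs ≡ []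
  rowWord-none []       _   = refl
  rowWord-none (c ∷ cs) out = trans (rowWord-reject cs (out (here refl))) (rowWord-none cs (out ∘ there))

  scanWord-reject : ∀ {i d c} → inRothe i c ≡ false → scanWord i (suc d) c ≡ scanWord i d (suc c)
  scanWord-reject {i} {d} {c} out =
    trans (cong (λ F → rowWord i (suc (length F)) (List.downFrom c)) (awaiting-reject out))
          (sym (rowWord-reject (List.downFrom c) out))

  scanWord-uncrossed : ∀ {i d c} → inRothe i c ≡ true → isCross (tile i c) ≡ false →
                       scanWord i (suc d) c ≡ scanWord i d (suc c)
  scanWord-uncrossed {i} {d} {c} isR uncrossed =
    trans (cong (λ m → rowWord i (suc m) (List.downFrom c)) (length-awaiting-accept isR))
          (sym (rowWord-uncrossed (List.downFrom c) isR uncrossed))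

  scanWord-crossed : ∀ {i d c} → inRothe i c ≡ true → isCross (tile i c) ≡ true →
                     scanWord i d (suc c) ≡ i + suc (length (awaiting i d (suc c))) ∷ scanWord i (suc d) c
  scanWord-crossed {i} {d} {c} isR crossed =
    trans (rowWord-crossed (List.downFrom c) isR crossed)
          (cong (λ m → i + suc (length (awaiting i d (suc c))) ∷ rowWord i (suc m) (List.downFrom c))
                (sym (length-awaiting-accept isR)))

  hpipe-step : ∀ {i d c w} → inRothe i c ≡ false → live (suc i) c ≡ false → tile i c ≡ hpipe →
               RowState i (suc d) c w → RowState i d (suc c) w
  hpipe-step {i} {d} {c} {w} out dead hp st =
    subst₂ (Invariant (ScannedBefore i (suc c))) (cong (_++ w) (scanWord-reject out)) frontier-eq
           (invariant-mono next-column st)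
    where
    frontier-eq : scanFrontier i (suc d) c ≡ scanFrontier i d (suc c)
    frontier-eq = trans (cong (λ F → exitsAbove i ++ F ++ left i c ∷ passedDown i c) (awaiting-reject out))
                        (cong₂ (λ x G → exitsAbove i ++ awaiting i d (suc c) ++ x ∷ G)
                               (sym (right-tile hp)) (sym (passedDown-reject dead)))

  elbow-step : ∀ {i d c w} → inRothe i c ≡ true → live (suc i) c ≡ true → tile i c ≡ elbow →
               RowState i (suc d) c w → RowState i d (suc c) w
  elbow-step {i} {d} {c} {w} isR alive el st =
    subst₂ (Invariant (ScannedBefore i (suc c))) (cong (_++ w) (scanWord-uncrossed isR (cong isCross el)))
           frontier-eq (invariant-mono next-column st)
    where
    P = exitsAbove i
    F = awaiting i d (suc c)
    G = passedDown i c
    frontier-eq : scanFrontier i (suc d) c ≡ scanFrontier i d (suc c)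
    frontier-eq = begin
      P ++ awaiting i (suc d) c ++ left i c ∷ G
        ≡⟨ cong (λ F′ → P ++ F′ ++ left i c ∷ G) (awaiting-accept isR) ⟩
      P ++ (F ++ top i c ∷ []) ++ left i c ∷ G
        ≡⟨ cong (P ++_) (ListP.++-assoc F (top i c ∷ []) (left i c ∷ G)) ⟩
      P ++ F ++ top i c ∷ left i c ∷ G
        ≡⟨ cong₂ (λ x y → P ++ F ++ x ∷ y ∷ G) (sym (right-tile el)) (sym (down-tile el)) ⟩
      P ++ F ++ left i (suc c) ∷ down i c ∷ G
        ≡⟨ cong (λ G′ → P ++ F ++ left i (suc c) ∷ G′) (passedDown-accept alive) ⟨
      P ++ F ++ left i (suc c) ∷ passedDown i (suc c) ∎
      where open ≡-Reasoning

  crossed-step : ∀ {i d c w} (i<n : i < n) (c<n : c < n) → inRothe i c ≡ true → live (suc i) c ≡ true →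
                 tile i c ≡ cross → RowState i (suc d) c w → RowState i d (suc c) w
  crossed-step {i} {d} {c} {w} i<n c<n isR alive cr st =
    subst₂ (Invariant (ScannedBefore i (suc c))) word-eq frontier-after
      (cross-step (P ++ F) (top i c) (left i c) G b₁ b₂ (trans (sym (tile-fromℕ< i<n c<n)) cr)
                  unscanned scanned next-column
                  (cong₂ top (sym ⟨i⟩) (sym ⟨c⟩)) (cong₂ left (sym ⟨i⟩) (sym ⟨c⟩))
                  (subst (Invariant (ScannedBefore i c) (scanWord i (suc d) c ++ w)) frontier-before st))
    where
    P = exitsAbove i
    F = awaiting i d (suc c)
    G = passedDown i c
    b₁ = fromℕ< i<n
    b₂ = fromℕ< c<n
    ⟨i⟩ : toℕ b₁ ≡ i
    ⟨i⟩ = toℕ-fromℕ< i<n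
    ⟨c⟩ : toℕ b₂ ≡ c
    ⟨c⟩ = toℕ-fromℕ< c<n
    unscanned : ¬ ScannedBefore i c b₁ b₂
    unscanned (inj₁ lt)       = ℕP.<-irrefl ⟨i⟩ lt
    unscanned (inj₂ (_ , lt)) = ℕP.<-irrefl ⟨c⟩ lt
    scanned : ScannedBefore i (suc c) b₁ b₂
    scanned = inj₂ (⟨i⟩ , ℕP.≤-reflexive (cong suc ⟨c⟩))
    frontier-before : scanFrontier i (suc d) c ≡ (P ++ F) ++ top i c ∷ left i c ∷ G
    frontier-before = begin
      P ++ awaiting i (suc d) c ++ left i c ∷ G
        ≡⟨ cong (λ F′ → P ++ F′ ++ left i c ∷ G) (awaiting-accept isR) ⟩
      P ++ (F ++ top i c ∷ []) ++ left i c ∷ G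
        ≡⟨ cong (P ++_) (ListP.++-assoc F (top i c ∷ []) (left i c ∷ G)) ⟩
      P ++ F ++ top i c ∷ left i c ∷ G
        ≡⟨ ListP.++-assoc P F _ ⟨
      (P ++ F) ++ top i c ∷ left i c ∷ G ∎
      where open ≡-Reasoning
    frontier-after : (P ++ F) ++ left i c ∷ top i c ∷ G ≡ scanFrontier i d (suc c)
    frontier-after = begin
      (P ++ F) ++ left i c ∷ top i c ∷ G
        ≡⟨ ListP.++-assoc P F _ ⟩
      P ++ F ++ left i c ∷ top i c ∷ G
        ≡⟨ cong₂ (λ x y → P ++ F ++ x ∷ y ∷ G) (sym (right-tile cr)) (sym (down-tile cr)) ⟩
      P ++ F ++ left i (suc c) ∷ down i c ∷ G
        ≡⟨ cong (λ G′ → P ++ F ++ left i (suc c) ∷ G′) (passedDown-accept alive) ⟨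
      P ++ F ++ left i (suc c) ∷ passedDown i (suc c) ∎
      where open ≡-Reasoning
    position-eq : suc (length (P ++ F)) ≡ i + suc (length F)
    position-eq =
      trans (cong suc (trans (ListP.length-++ P) (cong (_+ length F) (ListP.length-applyUpTo rowExit i))))
            (sym (ℕP.+-suc i (length F)))
    word-eq : suc (length (P ++ F)) ∷ scanWord i (suc d) c ++ w ≡ scanWord i d (suc c) ++ w
    word-eq = cong (_++ w) (trans (cong (_∷ scanWord i (suc d) c) position-eq)
                                  (sym (scanWord-crossed isR (cong isCross cr))))

  rowStep : ∀ {i d c w} → i < n → c + suc d ≡ n → u⁺ i < c →
            RowState i (suc d) c w → RowState i d (suc c) w
  rowStep {i} {d} {c} {w} i<n c+d≡n u<c = step (boxType i<n c<n)
    where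
    c<n : c < n
    c<n = subst (c <_) c+d≡n (ℕP.m<m+n c (s≤s z≤n))
    step : BoxType i c → RowState i (suc d) c w → RowState i d (suc c) w
    step (emptyBox c<u _ _)                 = ⊥-elim (ℕP.<-asym c<u u<c)
    step (vpipeBox c<u _ _ _)               = ⊥-elim (ℕP.<-asym c<u u<c)
    step (pivotBox c≡u _ _ _)               = ⊥-elim (ℕP.<-irrefl (sym c≡u) u<c)
    step (hpipeBox _ out _ dead hp)         = hpipe-step out dead hp
    step (rotheBox _ isR _ alive (inj₂ el)) = elbow-step isR alive el
    step (rotheBox _ isR _ alive (inj₁ cr)) = crossed-step i<n c<n isR alive cr

  rowLoop : ∀ {i w} d c → i < n → c + d ≡ n → u⁺ i < c → RowState i d c w → RowState i 0 n w
  rowLoop {i} {w} zero c i<n c+0≡n u<c =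
    subst (λ c′ → RowState i 0 c′ w) (trans (sym (ℕP.+-identityʳ c)) c+0≡n)
  rowLoop (suc d) c i<n c+d≡n u<c =
    rowLoop d (suc c) i<n (trans (sym (ℕP.+-suc c d)) c+d≡n) (ℕP.m<n⇒m<1+n u<c) ∘ rowStep i<n c+d≡n u<c

  pivot-column : ∀ {i} → i < n →
                 live i (u⁺ i) ≡ true × live (suc i) (u⁺ i) ≡ false × tile i (u⁺ i) ≡ pivot
  pivot-column i<n with boxType i<n (u⁺<n i<n)
  ... | emptyBox u<u _ _         = ⊥-elim (ℕP.<-irrefl refl u<u)
  ... | vpipeBox u<u _ _ _       = ⊥-elim (ℕP.<-irrefl refl u<u)
  ... | pivotBox _ alive dead pv = alive , dead , pv
  ... | hpipeBox u<u _ _ _ _     = ⊥-elim (ℕP.<-irrefl refl u<u)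
  ... | rotheBox u<u _ _ _ _     = ⊥-elim (ℕP.<-irrefl refl u<u)

  right-of-pivot : ∀ {i j} → i < n → j < n → u⁺ i < j → live i j ≡ inRothe i j
  right-of-pivot i<n j<n u<j with boxType i<n j<n
  ... | emptyBox j<u _ _         = ⊥-elim (ℕP.<-asym j<u u<j)
  ... | vpipeBox j<u _ _ _       = ⊥-elim (ℕP.<-asym j<u u<j)
  ... | pivotBox j≡u _ _ _       = ⊥-elim (ℕP.<-irrefl (sym j≡u) u<j)
  ... | hpipeBox _ out dead _ _  = trans dead (sym out)
  ... | rotheBox _ isR alive _ _ = trans alive (sym isR)

  left-of-pivot : ∀ {i j} → i < n → j < u⁺ i →
                  live i j ≡ live (suc i) j × (live i j ≡ true → top i j ≡ down i j)
  left-of-pivot i<n j<u with boxType i<n (ℕP.<-trans j<u (u⁺<n i<n))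
  ... | emptyBox _ dead dead′     = trans dead (sym dead′) , λ alive → contradiction (trans (sym alive) dead) λ ()
  ... | vpipeBox _ alive alive′ vp = trans alive (sym alive′) , λ _ → sym (down-tile vp)
  ... | pivotBox j≡u _ _ _         = ⊥-elim (ℕP.<-irrefl j≡u j<u)
  ... | hpipeBox u<j _ _ _ _       = ⊥-elim (ℕP.<-asym u<j j<u)
  ... | rotheBox u<j _ _ _ _       = ⊥-elim (ℕP.<-asym u<j j<u)

  rowFrontier-at-pivot : ∀ {i} → i < n →
    pick (live i) (top i) (List.downFrom n)
    ≡ awaiting i (n ∸ suc (u⁺ i)) (suc (u⁺ i)) ++ left i (suc (u⁺ i)) ∷ passedDown i (suc (u⁺ i))
  rowFrontier-at-pivot {i} i<n = begin
    pick (live i) (top i) (List.downFrom n)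
      ≡⟨ cong (pick (live i) (top i) ∘ List.downFrom) (ℕP.m∸n+n≡m u<n) ⟨
    pick (live i) (top i) (List.downFrom (d₀ + c₀))
      ≡⟨ cong (pick (live i) (top i)) (downFrom-+ d₀ c₀) ⟩
    pick (live i) (top i) (List.applyDownFrom (c₀ +_) d₀ ++ List.downFrom c₀)
      ≡⟨ pick-++ (live i) (top i) (List.applyDownFrom (c₀ +_) d₀) (List.downFrom c₀) ⟩
    pick (live i) (top i) (List.applyDownFrom (c₀ +_) d₀) ++ pick (live i) (top i) (List.downFrom c₀)
      ≡⟨ cong₂ _++_ (pick-cong (List.applyDownFrom (c₀ +_) d₀) rightwards (λ _ _ → refl))
                    (pick-accept (live i) (top i) (List.downFrom (u⁺ i)) alive) ⟩
    awaiting i d₀ c₀ ++ top i (u⁺ i) ∷ pick (live i) (top i) (List.downFrom (u⁺ i))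
      ≡⟨ cong₂ (λ x G → awaiting i d₀ c₀ ++ x ∷ G) (sym (right-tile pv))
               (pick-cong (List.downFrom (u⁺ i)) (proj₁ ∘ leftwards) (proj₂ ∘ leftwards)) ⟩
    awaiting i d₀ c₀ ++ left i c₀ ∷ pick (live (suc i)) (down i) (List.downFrom (u⁺ i))
      ≡⟨ cong (λ G → awaiting i d₀ c₀ ++ left i c₀ ∷ G) (passedDown-reject dead) ⟨
    awaiting i d₀ c₀ ++ left i c₀ ∷ passedDown i c₀ ∎
    where
    open ≡-Reasoning
    c₀ = suc (u⁺ i)
    d₀ = n ∸ c₀
    u<n : u⁺ i < n
    u<n = u⁺<n i<n
    alive = proj₁ (pivot-column i<n)
    dead  = proj₁ (proj₂ (pivot-column i<n))
    pv    = proj₂ (proj₂ (pivot-column i<n))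
    rightwards : ∀ {j} → j ∈ List.applyDownFrom (c₀ +_) d₀ → live i j ≡ inRothe i j
    rightwards j∈ with ∈-applyDownFrom⁻ (c₀ +_) j∈
    ... | k , k<d₀ , refl = right-of-pivot i<n j<n (ℕP.m≤m+n c₀ k)
      where
      j<n : c₀ + k < n
      j<n = subst (c₀ + k <_) (ℕP.m+[n∸m]≡n u<n) (ℕP.+-monoʳ-< c₀ k<d₀)
    leftwards : ∀ {j} → j ∈ List.downFrom (u⁺ i) →
                live i j ≡ live (suc i) j × (live i j ≡ true → top i j ≡ down i j)
    leftwards j∈ = left-of-pivot i<n (∈-downFrom⁻ j∈)

  rowStart : ∀ {i w} → i < n → Invariant (ScannedBefore i 0) w (rowFrontier i) →
             RowState i (n ∸ suc (u⁺ i)) (suc (u⁺ i)) w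
  rowStart {i} {w} i<n I =
    subst₂ (Invariant (ScannedBefore i (suc (u⁺ i)))) (sym word-eq)
           (cong (exitsAbove i ++_) (rowFrontier-at-pivot i<n))
           (invariant-mono (λ { (inj₁ a<i) → inj₁ a<i }) I)
    where
    outside : ∀ {j} → j ∈ List.downFrom (suc (u⁺ i)) → inRothe i j ≡ false
    outside {j} j∈ =
      cong (_∧ (i ℕ.<ᵇ u⁻ j)) (<ᵇ-false (ℕP.≤⇒≯ (ℕP.m<1+n⇒m≤n (∈-downFrom⁻ j∈))))
    word-eq : scanWord i (n ∸ suc (u⁺ i)) (suc (u⁺ i)) ++ w ≡ w
    word-eq = cong (_++ w) (rowWord-none (List.downFrom (suc (u⁺ i))) outside)

  rowEnd : ∀ {i w} → i < n → RowState i 0 n w →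
           Invariant (ScannedBefore (suc i) 0) (rowWord i 1 (List.downFrom n) ++ w) (rowFrontier (suc i))
  rowEnd {i} {w} i<n st = subst (Invariant (ScannedBefore (suc i) 0) _) frontier-eq (invariant-mono next-row st)
    where
    next-row : ∀ {a b} → ScannedBefore i n a b → ScannedBefore (suc i) 0 a b
    next-row (inj₁ a<i)       = inj₁ (ℕP.m<n⇒m<1+n a<i)
    next-row (inj₂ (a≡i , _)) = inj₁ (ℕP.≤-reflexive (cong suc a≡i))
    left-last : left i n ≡ rowExit i
    left-last = cong (left i) (sym (ℕP.m+[n∸m]≡n (ℕP.≤-trans (s≤s z≤n) i<n)))
    frontier-eq : scanFrontier i 0 n ≡ rowFrontier (suc i)
    frontier-eq = begin
      exitsAbove i ++ left i n ∷ passedDown i n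
        ≡⟨ cong (λ x → exitsAbove i ++ x ∷ passedDown i n) left-last ⟩
      exitsAbove i ++ rowExit i ∷ passedDown i n
        ≡⟨ ListP.++-assoc (exitsAbove i) (rowExit i ∷ []) _ ⟨
      (exitsAbove i ++ rowExit i ∷ []) ++ passedDown i n
        ≡⟨ cong (_++ passedDown i n) (ListP.applyUpTo-∷ʳ rowExit i) ⟩
      exitsAbove (suc i) ++ passedDown i n ∎
      where open ≡-Reasoning

  rowsWord : List ℕ → List ℕ
  rowsWord []       = []
  rowsWord (r ∷ rs) = rowWord r 1 (List.downFrom n) ++ rowsWord rs

  initial : Invariant (ScannedBefore 0 0) [] (rowFrontier 0)
  initial = record
    { frontier-length    = trans (cong length (all-live (List.downFrom n))) (ListP.length-downFrom n)
    ; word               = []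
    ; frontier           = λ x → trans (cong (_‼ toℕ x) (all-live (List.downFrom n)))
                                       (trans (‼-downFrom (toℕ<n x)) (sym (FinP.opposite-prop x)))
    ; length≤inversions  = z≤n
    ; inversions-crossed = λ x y x<y y<x → ⊥-elim (ℕP.<-asym x<y y<x)
    }
    where
    all-live : ∀ cs → pick (live 0) (top 0) cs ≡ cs
    all-live []       = refl
    all-live (c ∷ cs) = cong (c ∷_) (all-live cs)

  sweep : ∀ i → i ≤ n → Invariant (ScannedBefore i 0) (rowsWord (List.downFrom i)) (rowFrontier i)
  sweep zero    _   = initial
  sweep (suc i) i<n =
    rowEnd i<n (rowLoop (n ∸ suc (u⁺ i)) (suc (u⁺ i)) i<n (ℕP.m+[n∸m]≡n (u⁺<n i<n)) (ℕP.n<1+n _)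
                        (rowStart i<n (sweep i (ℕP.<⇒≤ i<n))))

  final : ∀ {S w} → Invariant S w (rowFrontier n) → (∀ x → ⟦ v ⟧ (prod w x) ≡ w₀ x) × Reduced n w
  final {w = w} I = exits-w₀ , length≤inversions⇒reduced w length≤inversions
    where
    open Invariant I
    exits-w₀ : ∀ x → ⟦ v ⟧ (prod w x) ≡ w₀ x
    exits-w₀ x = toℕ-injective (begin
      toℕ (⟦ v ⟧ q)          ≡⟨ proj₂ (pipe-labelled D (⟦ v ⟧ q)) q (exit q) ⟨
      rowExit (toℕ q)        ≡⟨ ‼-applyUpTo rowExit (toℕ<n q) ⟨
      exitsAbove n ‼ toℕ q   ≡⟨ ‼-++ˡ (exitsAbove n) _ q<n ⟨
      rowFrontier n ‼ toℕ q  ≡⟨ frontier x ⟩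
      toℕ (w₀ x)             ∎)
      where
      open ≡-Reasoning
      q = prod w x
      q<n : toℕ q < length (exitsAbove n)
      q<n = subst (toℕ q <_) (sym (ListP.length-applyUpTo rowExit n)) (toℕ<n q)

  inRothe-toℕ : ∀ i j → rotheᵇ u i j ≡ inRothe (toℕ i) (toℕ j)
  inRothe-toℕ i j = sym (cong₂ (λ a b → (a ℕ.<ᵇ toℕ j) ∧ (toℕ i ℕ.<ᵇ b))
                               (extend-toℕ 0 (λ i → toℕ (u ⟨$⟩ʳ i)) i)
                               (extend-toℕ 0 (λ j → toℕ (u ⟨$⟩ˡ j)) j))

  -- Parameterised by the functions crossWord applies to the boxes, so that the
  -- pattern-matching lambdas of its definition can be supplied, with their equations by refl.
  module CrossWord (index : ℕ × Fin n × Fin n → ℕ) (crossBox : ℕ × Fin n × Fin n → Bool)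
                   (index-≡ : ∀ k i j → index (k , i , j) ≡ k)
                   (crossBox-≡ : ∀ k i j → crossBox (k , i , j) ≡ isCross (D i j)) where

    crossIndices : List (ℕ × Fin n × Fin n) → List ℕ
    crossIndices = List.map index ∘ List.filterᵇ crossBox

    crossIndices-++ : ∀ bs bs′ → crossIndices (bs ++ bs′) ≡ crossIndices bs ++ crossIndices bs′
    crossIndices-++ bs bs′ =
      trans (cong (List.map index) (ListP.filter-++ (T? ∘ crossBox) bs bs′))
            (ListP.map-++ index (List.filterᵇ crossBox bs) (List.filterᵇ crossBox bs′))

    crossIndices-crossed : ∀ {b k i j} bs → b ≡ (k , i , j) → isCross (D i j) ≡ true →
                           crossIndices (b ∷ bs) ≡ k ∷ crossIndices bs
    crossIndices-crossed bs refl crossed =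
      trans (cong (List.map index) (filterᵇ-accept crossBox bs (trans (crossBox-≡ _ _ _) crossed)))
            (cong (_∷ crossIndices bs) (index-≡ _ _ _))

    crossIndices-uncrossed : ∀ {b k i j} bs → b ≡ (k , i , j) → isCross (D i j) ≡ false →
                             crossIndices (b ∷ bs) ≡ crossIndices bs
    crossIndices-uncrossed bs refl uncrossed =
      cong (List.map index) (filterᵇ-reject crossBox bs (trans (crossBox-≡ _ _ _) uncrossed))

    row-link : ∀ i (box : ℕ × Fin n → ℕ × Fin n × Fin n) →
               (∀ h j → box (h , j) ≡ (toℕ i + h , i , j)) →
               ∀ h xs → crossIndices (List.map box (number h (List.filterᵇ (rotheᵇ u i) xs)))
                        ≡ rowWord (toℕ i) h (List.map toℕ xs)
    row-link i box box-≡ h []       = refl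
    row-link i box box-≡ h (x ∷ xs) = by-rothe (rotheᵇ u i x) refl
      where
      boxesFrom : ℕ → List (Fin n) → List (ℕ × Fin n × Fin n)
      boxesFrom h ys = List.map box (number h (List.filterᵇ (rotheᵇ u i) ys))
      by-cross : (b : Bool) → isCross (D i x) ≡ b → inRothe (toℕ i) (toℕ x) ≡ true →
                 crossIndices (box (h , x) ∷ boxesFrom (suc h) xs)
                 ≡ rowWord (toℕ i) h (List.map toℕ (x ∷ xs))
      by-cross true crossed isR =
        trans (crossIndices-crossed _ (box-≡ h x) crossed)
              (trans (cong (toℕ i + h ∷_) (row-link i box box-≡ (suc h) xs))
                     (sym (rowWord-crossed (List.map toℕ xs) isR (trans (cong isCross (tile-toℕ i x)) crossed))))
      by-cross false uncrossed isR =
        trans (crossIndices-uncrossed _ (box-≡ h x) uncrossed)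
              (trans (row-link i box box-≡ (suc h) xs)
                     (sym (rowWord-uncrossed (List.map toℕ xs) isR
                                             (trans (cong isCross (tile-toℕ i x)) uncrossed))))
      by-rothe : (b : Bool) → rotheᵇ u i x ≡ b →
                 crossIndices (boxesFrom h (x ∷ xs)) ≡ rowWord (toℕ i) h (List.map toℕ (x ∷ xs))
      by-rothe true isR =
        trans (cong (crossIndices ∘ List.map box ∘ number h) (filterᵇ-accept (rotheᵇ u i) xs isR))
              (by-cross (isCross (D i x)) refl (trans (sym (inRothe-toℕ i x)) isR))
      by-rothe false out =
        trans (cong (crossIndices ∘ List.map box ∘ number h) (filterᵇ-reject (rotheᵇ u i) xs out))
              (trans (row-link i box box-≡ h xs)
                     (sym (rowWord-reject (List.map toℕ xs) (trans (sym (inRothe-toℕ i x)) out))))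

    rows-link : ∀ rs → crossIndices (List.concat (List.map (rowBoxes u) rs)) ≡ rowsWord (List.map toℕ rs)
    rows-link []       = refl
    rows-link (r ∷ rs) = trans (crossIndices-++ (rowBoxes u r) _) (cong₂ _++_ row (rows-link rs))
      where
      row : crossIndices (rowBoxes u r) ≡ rowWord (toℕ r) 1 (List.downFrom n)
      row = trans (row-link r _ (λ _ _ → refl) 1 (reverse (List.allFin n)))
                  (cong (rowWord (toℕ r) 1) (toℕ-reverse-allFin n))

  crossWord≡rowsWord : crossWord u D ≡ rowsWord (List.downFrom n)
  crossWord≡rowsWord =
    trans (CrossWord.rows-link _ _ (λ _ _ _ → refl) (λ _ _ _ → refl) (reverse (List.allFin n)))
          (cong rowsWord (toℕ-reverse-allFin n))

lemma3p13 : (n : ℕ) (u v : Permutation′ n) (D : Tiling n) →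
    u ≤B v → IsFPP u v D →
    (∀ (x : Fin n) → ⟦ v ⟧ (prod (crossWord u D) x) ≡ w₀ x)
    × Reduced n (crossWord u D)
lemma3p13 n u v D _ fpp =
  subst (λ w → (∀ x → ⟦ v ⟧ (prod w x) ≡ w₀ x) × Reduced n w) (sym crossWord≡rowsWord)
        (final (sweep n ℕP.≤-refl))
  where open Sweep u v D fpp
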